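{- Let $k\geq 2$ be an integer. No number is a Trott number in both base $k^2+1$ and base $k^2+k$; that is, $T_{k^2+1}\cap T_{k^2+k}=\emptyset$.
   Context: A real number $x$ is a Trott number in base $b$ if $x\in(0,1)$ has an infinite continued fraction expansion $x=[0;a_1,a_2,\dots]$ with all $a_i$ positive integers and the base-$b$ expansion of $x$ is $(0.\hat{a}_1\hat{a}_2\hat{a}_3\dots)_b$, where $\hat{a}_i$ is the string of base-$b$ digits of $a_i$ (without leading zeros), concatenated. $T_b$ is the set of Trott numbers in base $b$. -}

module Defs where

-- A real number is therefore
-- represented by a nested family of closed rational intervals (with lengths
-- tending to 0); two such families denote the same real iff every interval of
-- the first meets every interval of the second. Rationals are pairs
-- (numerator , denominator) of naturals, compared by cross-multiplication.

open import Data.Nat using (ℕ; zero; suc; _+_; _*_; _^_; _≤_; _<_; _≟_)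
open import Data.Nat.DivMod using (_/_; _%_)
open import Data.List using (List; []; _∷_; reverse; concatMap; take; foldl; upTo)
open import Data.Product using (_×_; _,_; ∃₂)
open import Data.Sum using (_⊎_)
open import Relation.Nullary using (yes; no)

-- a nonnegative fraction n/d (d > 0 in all uses below)
Frac : Set
Frac = ℕ × ℕ

_≤F_ : Frac → Frac → Set
(n₁ , d₁) ≤F (n₂ , d₂) = n₁ * d₂ ≤ n₂ * d₁

-- a closed interval given by its two endpoints (in either order)
Interval : Set
Interval = Frac × Frac

-- the closed intervals [min r s , max r s] and [min r' s' , max r' s'] intersect
Meets : Interval → Interval → Set
Meets (r , s) (r' , s') =
  ((r' ≤F r ⊎ s' ≤F r) ⊎ (r' ≤F s ⊎ s' ≤F s)) ×
  ((r ≤F r' ⊎ s ≤F r') ⊎ (r ≤F s' ⊎ s ≤F s'))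

SameReal : (ℕ → Interval) → (ℕ → Interval) → Set
SameReal I J = ∀ n m → Meets (I n) (J m)

-- Continued fractions [0; a₁, a₂, …], with a₁ = a 0, a₂ = a 1, …

Positive : (ℕ → ℕ) → Set
Positive a = ∀ i → 0 < a i

-- P a n = p_{n-1}, Q a n = q_{n-1}  (p_{-1}=1, q_{-1}=0, p_0=0, q_0=1,
-- p_n = a_n p_{n-1} + p_{n-2}, same for q)
PQ : (ℕ → ℕ) → ℕ → ℕ × ℕ
PQ a zero = 1 , 0
PQ a (suc zero) = 0 , 1
PQ a (suc (suc n)) with PQ a n | PQ a (suc n)
... | (p₀ , q₀) | (p₁ , q₁) = a n * p₁ + p₀ , a n * q₁ + q₀

convergent : (ℕ → ℕ) → ℕ → Frac
convergent a n = PQ a (suc n)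

-- the value of the infinite continued fraction lies between consecutive convergents
cfInterval : (ℕ → ℕ) → ℕ → Interval
cfInterval a n = convergent a n , convergent a (suc n)

digitsRev : ℕ → ℕ → ℕ → List ℕ
digitsRev zero b m = []
digitsRev (suc f) zero m = []
digitsRev (suc f) (suc b) m with m ≟ 0
... | yes _ = []
... | no _ = (m % suc b) ∷ digitsRev f (suc b) (m / suc b)

digits : ℕ → ℕ → List ℕ
digits b m = reverse (digitsRev m b m)

-- the first n digits after the radix point of (0. â₁ â₂ â₃ …)_b
-- (the first n terms contribute at least n digits, as every aᵢ ≥ 1)
digitPrefix : ℕ → (ℕ → ℕ) → ℕ → List ℕ
digitPrefix b a n = take n (concatMap (λ i → digits b (a i)) (upTo n))

fromDigits : ℕ → List ℕ → ℕ
fromDigits b = foldl (λ acc d → acc * b + d) 0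

-- (0.d₁…d_m)_b ≤ x ≤ (0.d₁…d_m)_b + b^{-m}
digitInterval : ℕ → (ℕ → ℕ) → ℕ → Interval
digitInterval b a m =
  (fromDigits b (digitPrefix b a m) , b ^ m) ,
  (suc (fromDigits b (digitPrefix b a m)) , b ^ m)

-- x = [0; a₁, a₂, …] (all aᵢ ≥ 1) is a Trott number in base b:
-- its base-b expansion is (0. â₁ â₂ â₃ …)_b
Trott : ℕ → (ℕ → ℕ) → Set
Trott b a = Positive a × SameReal (cfInterval a) (digitInterval b a)

module Submission where

-- The convergents p_n/q_n (n ≥ 3) of x = [0; a₁, a₂, …] lie in (1/(a₁ + 1/a₂), 1/(a₁ + 1/(a₂ + 1))],
-- and for a Trott number this interval must meet the intervals cut out by the leading base-b
-- digits â₁ and â₁ â₂. The first block forces a₁² < b < (a₁ + 1)², so a₁ = k in both bases k² + 1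
-- and k² + k, and then both expansions share a₂ = A. The second block bounds the scales
-- M = (k² + 1)^(l+1) and N = (k² + k)^(m+1), where (k² + 1)^l ≤ A: it gives M > kA + k² + 1, so
-- M ≠ k² + 1 and A ≥ k² + 1, and N = A + 2 unless A ≤ k² + k. As M ≡ 1 and kN ≡ 0 (mod k²), the
-- lower bound on M then rounds up far enough that A ≤ k² + k in every case, and for
-- k² + 1 ≤ A ≤ k² + k the upper bound on M fails.

open import Defs
open import Data.Nat
open import Data.Nat.Properties
open import Data.Nat.DivMod
open import Data.Nat.Tactic.RingSolver using (solve-∀)
open import Data.List using (List; []; _∷_; _++_; length; reverse; foldl; foldr; take; concatMap; applyUpTo)
open import Data.List.Properties using (length-reverse; reverse-foldl)
open import Data.Product using (Σ; _×_; _,_; proj₁; proj₂)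
open import Data.Sum using (_⊎_; inj₁; inj₂)
open import Data.Empty using (⊥; ⊥-elim)
open import Function using (_∘_)
open import Relation.Nullary using (¬_; Dec; yes; no)
open import Relation.Binary using (tri<; tri≈; tri>)
open import Relation.Binary.PropositionalEquality

cancel-≤ : ∀ {x y} c {u v} → x ≡ c + u → y ≡ c + v → x ≤ y → u ≤ v
cancel-≤ c {u} {v} refl refl = +-cancelˡ-≤ c u v

cancel-< : ∀ {x y} c {u v} → x ≡ c + u → y ≡ c + v → x < y → u < v
cancel-< c {u} {v} refl refl = +-cancelˡ-< c u v

pow-one-or-large : ∀ b e → 0 < b → b ^ e ≡ 1 ⊎ b ≤ b ^ e
pow-one-or-large b zero _ = inj₁ refl
pow-one-or-large b (suc e) b>0 =
  inj₂ (subst (_≤ b * b ^ e) (*-identityʳ b) (*-monoʳ-≤ b (m^n>0 b {{>-nonZero b>0}} e)))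

pow-≡1-mod : ∀ m n → Σ ℕ λ R → (m + 1) ^ n ≡ 1 + m * R
pow-≡1-mod m zero = 0 , cong suc (sym (*-zeroʳ m))
pow-≡1-mod m (suc n) with pow-≡1-mod m n
... | R , eq = R + 1 + m * R , trans (cong ((m + 1) *_) eq) (expand m R)
  where
  expand : ∀ m R → (m + 1) * (1 + m * R) ≡ 1 + m * (R + 1 + m * R)
  expand = solve-∀

squeeze-unique : ∀ {x y n} → x * x < n → n < suc x * suc x → y * y < n → n < suc y * suc y → x ≡ y
squeeze-unique {x} {y} x²<n n<[x+1]² y²<n n<[y+1]² with <-cmp x y
... | tri≈ _ x≡y _ = x≡y
... | tri< x<y _ _ = ⊥-elim (<⇒≱ n<[x+1]² (<⇒≤ (≤-<-trans (*-mono-≤ x<y x<y) y²<n)))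
... | tri> _ _ y<x = ⊥-elim (<⇒≱ n<[y+1]² (<⇒≤ (≤-<-trans (*-mono-≤ y<x y<x) x²<n)))

between-squares⇒ : ∀ {k b} → 2 ≤ k → k * k < b → 2 ≤ b × k < b
between-squares⇒ {k} 2≤k k²<b = ≤-trans 2≤k (<⇒≤ k<b) , k<b
  where k<b = ≤-<-trans (m≤m*n k k {{>-nonZero (≤-trans (s≤s z≤n) 2≤k)}}) k²<b

k²<k²+1<[k+1]² : ∀ k → 0 < k → k * k < k * k + 1 × k * k + 1 < suc k * suc k
k²<k²+1<[k+1]² k k>0 =
  m<m+n (k * k) (s≤s z≤n) ,
  subst (k * k + 1 <_) (sym (square k)) (m<m+n (k * k + 1) (≤-trans k>0 (m≤m+n k k)))
  where
  square : ∀ k → suc k * suc k ≡ k * k + 1 + (k + k)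
  square = solve-∀

k²<k²+k<[k+1]² : ∀ k → 0 < k → k * k < k * k + k × k * k + k < suc k * suc k
k²<k²+k<[k+1]² k k>0 =
  m<m+n (k * k) k>0 ,
  subst (k * k + k <_) (sym (square k)) (m<m+n (k * k + k) (s≤s z≤n))
  where
  square : ∀ k → suc k * suc k ≡ k * k + k + suc k
  square = solve-∀

den : Frac → ℕ
den = proj₂

_<F_ : Frac → Frac → Set
(n₁ , d₁) <F (n₂ , d₂) = n₁ * d₂ < n₂ * d₁

<F⇒≱F : ∀ {x y} → x <F y → ¬ (y ≤F x)
<F⇒≱F {_ , _} {_ , _} = <⇒≱

_<F?_ : ∀ x y → Dec (x <F y)
(n₁ , d₁) <F? (n₂ , d₂) = n₁ * d₂ <? n₂ * d₁

≮F⇒≥F : ∀ {x y} → ¬ (x <F y) → y ≤F x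
≮F⇒≥F {_ , _} {_ , _} = ≮⇒≥

private
  *-swapʳ : ∀ x y z → x * y * z ≡ x * z * y
  *-swapʳ = solve-∀

≤F-<F-trans : ∀ {x y z} → 0 < den x → x ≤F y → y <F z → x <F z
≤F-<F-trans {a , b} {c , d} {e , f} b>0 x≤y y<z = *-cancelʳ-< d (a * f) (e * b) (begin-strict
  a * f * d  ≡⟨ *-swapʳ a f d ⟩
  a * d * f  ≤⟨ *-monoˡ-≤ f x≤y ⟩
  c * b * f  ≡⟨ *-swapʳ c b f ⟩
  c * f * b  <⟨ *-monoˡ-< b {{>-nonZero b>0}} y<z ⟩
  e * d * b  ≡⟨ *-swapʳ e d b ⟩
  e * b * d  ∎)
  where open ≤-Reasoning

<F-≤F-trans : ∀ {x y z} → 0 < den z → x <F y → y ≤F z → x <F z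
<F-≤F-trans {a , b} {c , d} {e , f} f>0 x<y y≤z = *-cancelʳ-< d (a * f) (e * b) (begin-strict
  a * f * d  ≡⟨ *-swapʳ a f d ⟩
  a * d * f  <⟨ *-monoˡ-< f {{>-nonZero f>0}} x<y ⟩
  c * b * f  ≡⟨ *-swapʳ c b f ⟩
  c * f * b  ≤⟨ *-monoˡ-≤ b y≤z ⟩
  e * d * b  ≡⟨ *-swapʳ e d b ⟩
  e * b * d  ∎)
  where open ≤-Reasoning

≤F-trans : ∀ {x y z} → 0 < den y → x ≤F y → y ≤F z → x ≤F z
≤F-trans {a , b} {c , d} {e , f} d>0 x≤y y≤z = *-cancelʳ-≤ (a * f) (e * b) d {{>-nonZero d>0}} (begin
  a * f * d  ≡⟨ *-swapʳ a f d ⟩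
  a * d * f  ≤⟨ *-monoˡ-≤ f x≤y ⟩
  c * b * f  ≡⟨ *-swapʳ c b f ⟩
  c * f * b  ≤⟨ *-monoˡ-≤ b y≤z ⟩
  e * d * b  ≡⟨ *-swapʳ e d b ⟩
  e * b * d  ∎)
  where open ≤-Reasoning

separated : ∀ {r s r' s'} m → 0 < den r → 0 < den s →
            r ≤F m → s ≤F m → m <F r' → m <F s' → ¬ Meets (r , s) (r' , s')
separated {r} {s} {r'} {s'} m r>0 s>0 r≤m s≤m m<r' m<s' (some≤ , _) with some≤
... | inj₁ (inj₁ r'≤r) = <F⇒≱F {r} {r'} (≤F-<F-trans {r} {m} {r'} r>0 r≤m m<r') r'≤r
... | inj₁ (inj₂ s'≤r) = <F⇒≱F {r} {s'} (≤F-<F-trans {r} {m} {s'} r>0 r≤m m<s') s'≤r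
... | inj₂ (inj₁ r'≤s) = <F⇒≱F {s} {r'} (≤F-<F-trans {s} {m} {r'} s>0 s≤m m<r') r'≤s
... | inj₂ (inj₂ s'≤s) = <F⇒≱F {s} {s'} (≤F-<F-trans {s} {m} {s'} s>0 s≤m m<s') s'≤s

separated′ : ∀ {r s r' s'} m → 0 < den r' → 0 < den s' →
             r' ≤F m → s' ≤F m → m <F r → m <F s → ¬ Meets (r , s) (r' , s')
separated′ {r} {s} {r'} {s'} m r'>0 s'>0 r'≤m s'≤m m<r m<s (_ , some≤) with some≤
... | inj₁ (inj₁ r≤r') = <F⇒≱F {r'} {r} (≤F-<F-trans {r'} {m} {r} r'>0 r'≤m m<r) r≤r'
... | inj₁ (inj₂ s≤r') = <F⇒≱F {r'} {s} (≤F-<F-trans {r'} {m} {s} r'>0 r'≤m m<s) s≤r'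
... | inj₂ (inj₁ r≤s') = <F⇒≱F {s'} {r} (≤F-<F-trans {s'} {m} {r} s'>0 s'≤m m<r) r≤s'
... | inj₂ (inj₂ s≤s') = <F⇒≱F {s'} {s} (≤F-<F-trans {s'} {m} {s} s'>0 s'≤m m<s) s≤s'

-- x ∈ (lo, hi]; the positive denominator is what the transitivity lemmas need.
record _∈⟨_,_] (x lo hi : Frac) : Set where
  constructor in⟨]
  field
    ∈-lower : lo <F x
    ∈-upper : x ≤F hi
    ∈-den>0 : 0 < den x

open _∈⟨_,_]

meets-digitInterval : ∀ {x y lo hi} v B → 0 < B → x ∈⟨ lo , hi ] → y ∈⟨ lo , hi ] →
                      Meets (x , y) ((v , B) , (suc v , B)) →
                      lo <F (suc v , B) × (v , B) ≤F hi
meets-digitInterval {x} {y} {lo} {hi} v B B>0 (in⟨] lo<x x≤hi x>0) (in⟨] lo<y y≤hi y>0) meets =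
  lo<v+1 , v≤hi
  where
  v≤v+1 : (v , B) ≤F (suc v , B)
  v≤v+1 = *-monoˡ-≤ B (n≤1+n v)
  lo<v+1 : lo <F (suc v , B)
  lo<v+1 with lo <F? (suc v , B)
  ... | yes lo<v+1 = lo<v+1
  ... | no lo≮v+1 = ⊥-elim (separated′ {x} {y} {v , B} {suc v , B} lo B>0 B>0
          (≤F-trans {v , B} {suc v , B} {lo} B>0 v≤v+1 v+1≤lo) v+1≤lo lo<x lo<y meets)
    where v+1≤lo = ≮F⇒≥F {lo} {suc v , B} lo≮v+1
  v≤hi : (v , B) ≤F hi
  v≤hi with hi <F? (v , B)
  ... | no hi≮v = ≮F⇒≥F {hi} {v , B} hi≮v
  ... | yes hi<v = ⊥-elim (separated {x} {y} {v , B} {suc v , B} hi x>0 y>0 x≤hi y≤hi hi<v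
          (<F-≤F-trans {hi} {v , B} {suc v , B} B>0 hi<v v≤v+1) meets)

∈⟨⟩-apart : ∀ {x y x' y' lo hi lo' hi'} → 0 < den hi → hi ≤F lo' →
            x ∈⟨ lo , hi ] → y ∈⟨ lo , hi ] → x' ∈⟨ lo' , hi' ] → y' ∈⟨ lo' , hi' ] →
            ¬ Meets (x , y) (x' , y') × ¬ Meets (x' , y') (x , y)
∈⟨⟩-apart {x} {y} {x'} {y'} {_} {hi} {lo'} hi>0 hi≤lo'
  (in⟨] _ x≤hi x>0) (in⟨] _ y≤hi y>0) (in⟨] lo'<x' _ _) (in⟨] lo'<y' _ _) =
  separated {x} {y} {x'} {y'} hi x>0 y>0 x≤hi y≤hi hi<x' hi<y' ,
  separated′ {x'} {y'} {x} {y} hi x>0 y>0 x≤hi y≤hi hi<x' hi<y'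
  where
  hi<x' = ≤F-<F-trans {hi} {lo'} {x'} hi>0 hi≤lo' lo'<x'
  hi<y' = ≤F-<F-trans {hi} {lo'} {y'} hi>0 hi≤lo' lo'<y'

-- invAdd q x = 1 / (q + x)
invAdd : ℕ → Frac → Frac
invAdd q (p , r) = r , q * r + p

private
  invAdd-cross : ∀ q p r p' r' → r * (q * r' + p') ≡ q * r * r' + p' * r
  invAdd-cross = solve-∀

invAdd-antitone-≤ : ∀ q {x y} → y ≤F x → invAdd q x ≤F invAdd q y
invAdd-antitone-≤ q {p , r} {p' , r'} y≤x = begin
  r * (q * r' + p')  ≡⟨ invAdd-cross q p r p' r' ⟩
  q * r * r' + p' * r ≤⟨ +-monoʳ-≤ (q * r * r') y≤x ⟩
  q * r * r' + p * r' ≡⟨ cong (_+ p * r') (*-swapʳ q r r') ⟩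
  q * r' * r + p * r' ≡⟨ invAdd-cross q p' r' p r ⟨
  r' * (q * r + p)    ∎
  where open ≤-Reasoning

invAdd-antitone-< : ∀ q {x y} → y <F x → invAdd q x <F invAdd q y
invAdd-antitone-< q {p , r} {p' , r'} y<x = begin-strict
  r * (q * r' + p')  ≡⟨ invAdd-cross q p r p' r' ⟩
  q * r * r' + p' * r <⟨ +-monoʳ-< (q * r * r') y<x ⟩
  q * r * r' + p * r' ≡⟨ cong (_+ p * r') (*-swapʳ q r r') ⟩
  q * r' * r + p * r' ≡⟨ invAdd-cross q p' r' p r ⟨
  r' * (q * r + p)    ∎
  where open ≤-Reasoning

invAdd-0 : ∀ q → invAdd q (0 , 1) ≡ (1 , q)
invAdd-0 q = cong (1 ,_) (trans (+-identityʳ (q * 1)) (*-identityʳ q))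

invAdd-1 : ∀ q → invAdd q (1 , 1) ≡ (1 , suc q)
invAdd-1 q = cong (1 ,_) (trans (+-comm (q * 1) 1) (cong suc (*-identityʳ q)))

-- PQ a (2 + n) reduces to cfStep (a n) (PQ a (1 + n)) (PQ a n)
cfStep : ℕ → Frac → Frac → Frac
cfStep c (p₁ , q₁) (p₀ , q₀) = c * p₁ + p₀ , c * q₁ + q₀

invAdd-cfStep : ∀ q c u v → invAdd q (cfStep c u v) ≡ cfStep c (invAdd q u) (invAdd q v)
invAdd-cfStep q c (p₁ , q₁) (p₀ , q₀) = cong (c * q₁ + q₀ ,_) (linear q c p₁ q₁ p₀ q₀)
  where
  linear : ∀ q c p₁ q₁ p₀ q₀ → q * (c * q₁ + q₀) + (c * p₁ + p₀) ≡ c * (q * q₁ + p₁) + (q * q₀ + p₀)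
  linear = solve-∀

PQ-suc : ∀ a n → PQ a (suc n) ≡ invAdd (a 0) (PQ (a ∘ suc) n)
PQ-suc a n = proj₁ (PQ-suc² n)
  where
  PQ-suc² : ∀ n → PQ a (suc n) ≡ invAdd (a 0) (PQ (a ∘ suc) n) ×
                  PQ a (suc (suc n)) ≡ invAdd (a 0) (PQ (a ∘ suc) (suc n))
  PQ-suc² zero = cong (0 ,_) (sym a₀*0+1≡1) , cong (_, a 0 * 1 + 0) a₀*0+1≡1
    where a₀*0+1≡1 = cong (_+ 1) (*-zeroʳ (a 0))
  PQ-suc² (suc n) with PQ-suc² n
  ... | eq₀ , eq₁ = eq₁ , (begin
    cfStep (a (suc n)) (PQ a (suc (suc n))) (PQ a (suc n))
      ≡⟨ cong₂ (cfStep (a (suc n))) eq₁ eq₀ ⟩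
    cfStep (a (suc n)) (invAdd (a 0) (PQ (a ∘ suc) (suc n))) (invAdd (a 0) (PQ (a ∘ suc) n))
      ≡⟨ invAdd-cfStep (a 0) (a (suc n)) (PQ (a ∘ suc) (suc n)) (PQ (a ∘ suc) n) ⟨
    invAdd (a 0) (PQ (a ∘ suc) (suc (suc n))) ∎)
    where open ≡-Reasoning

invAdd-∈⟨0,1] : ∀ {q} x → 0 < q → 0 < den x → invAdd q x ∈⟨ (0 , 1) , (1 , 1) ]
invAdd-∈⟨0,1] {q} (p , r) q>0 r>0 = in⟨]
  (subst (0 <_) (sym (*-identityʳ r)) r>0)
  (subst₂ _≤_ (sym (*-identityʳ r)) (sym (*-identityˡ (q * r + p)))
    (≤-trans (m≤n*m r q {{>-nonZero q>0}}) (m≤m+n (q * r) p)))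
  (≤-trans r>0 (≤-trans (m≤n*m r q {{>-nonZero q>0}}) (m≤m+n (q * r) p)))

PQ-∈⟨0,1] : ∀ {a} → Positive a → ∀ n → PQ a (2 + n) ∈⟨ (0 , 1) , (1 , 1) ]
PQ-∈⟨0,1] {a} pos n =
  subst (_∈⟨ (0 , 1) , (1 , 1) ]) (sym (PQ-suc a (suc n)))
    (invAdd-∈⟨0,1] (PQ (a ∘ suc) (suc n)) (pos 0) (tail-den>0 n))
  where
  tail-den>0 : ∀ n → 0 < den (PQ (a ∘ suc) (suc n))
  tail-den>0 zero = s≤s z≤n
  tail-den>0 (suc n) = ∈-den>0 (PQ-∈⟨0,1] (pos ∘ suc) n)

-- the value of [0; q, t]
cf₂ : ℕ → ℕ → Frac
cf₂ q t = invAdd q (1 , t)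

cf₂-den>0 : ∀ q t → 0 < den (cf₂ q t)
cf₂-den>0 q t = subst (0 <_) (+-comm 1 (q * t)) (s≤s z≤n)

cf₂-monotone : ∀ q {t t'} → t ≤ t' → cf₂ q t ≤F cf₂ q t'
cf₂-monotone q {t} {t'} t≤t' =
  invAdd-antitone-≤ q {1 , t} {1 , t'} (subst₂ _≤_ (sym (*-identityˡ t)) (sym (*-identityˡ t')) t≤t')

cf₂<1/q : ∀ q t → cf₂ q t <F (1 , q)
cf₂<1/q q t = subst₂ _<_ (*-comm q t) (sym (*-identityˡ (q * t + 1))) (m<m+n (q * t) (s≤s z≤n))

convergent-∈ : ∀ {a} → Positive a → ∀ n →
               convergent a (3 + n) ∈⟨ cf₂ (a 0) (a 1) , cf₂ (a 0) (suc (a 1)) ]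
convergent-∈ {a} pos n = subst (_∈⟨ cf₂ (a 0) (a 1) , cf₂ (a 0) (suc (a 1)) ]) (sym unfold)
  (in⟨] (invAdd-antitone-< (a 0) {1 , a 1} {y} y<1/a₁)
        (invAdd-antitone-≤ (a 0) {y} {1 , suc (a 1)} 1/[1+a₁]≤y)
        (≤-trans (∈-den>0 x-bounds) (m≤n+m (den x) (a 0 * den y))))
  where
  x = PQ (a ∘ suc ∘ suc) (2 + n)
  y = invAdd (a 1) x
  unfold : convergent a (3 + n) ≡ invAdd (a 0) y
  unfold = trans (PQ-suc a (3 + n)) (cong (invAdd (a 0)) (PQ-suc (a ∘ suc) (2 + n)))
  x-bounds = PQ-∈⟨0,1] (pos ∘ suc ∘ suc) n
  y<1/a₁ : y <F (1 , a 1)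
  y<1/a₁ = subst (y <F_) (invAdd-0 (a 1)) (invAdd-antitone-< (a 1) {x} {0 , 1} (∈-lower x-bounds))
  1/[1+a₁]≤y : (1 , suc (a 1)) ≤F y
  1/[1+a₁]≤y = subst (_≤F y) (invAdd-1 (a 1))
                 (invAdd-antitone-≤ (a 1) {1 , 1} {x} (∈-upper x-bounds))

cfIntervals-apart : ∀ {a c} → Positive a → Positive c → a 0 ≡ c 0 → a 1 < c 1 →
                    ¬ Meets (cfInterval a 3) (cfInterval c 3) × ¬ Meets (cfInterval c 3) (cfInterval a 3)
cfIntervals-apart {a} {c} pa pc a₀≡c₀ a₁<c₁ =
  ∈⟨⟩-apart (cf₂-den>0 (a 0) (suc (a 1))) (cf₂-monotone (a 0) a₁<c₁)
            (convergent-∈ pa 0) (convergent-∈ pa 1) (in-a₀-terms 0) (in-a₀-terms 1)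
  where
  in-a₀-terms : ∀ n → convergent c (3 + n) ∈⟨ cf₂ (a 0) (c 1) , cf₂ (a 0) (suc (c 1)) ]
  in-a₀-terms n = subst (λ q → convergent c (3 + n) ∈⟨ cf₂ q (c 1) , cf₂ q (suc (c 1)) ])
                        (sym a₀≡c₀) (convergent-∈ pc n)

second-quotients-agree : ∀ {a c} → Positive a → Positive c → a 0 ≡ c 0 →
                         Meets (cfInterval a 3) (cfInterval c 3) → a 1 ≡ c 1
second-quotients-agree {a} {c} pa pc a₀≡c₀ meets with <-cmp (a 1) (c 1)
... | tri≈ _ a₁≡c₁ _ = a₁≡c₁
... | tri< a₁<c₁ _ _ = ⊥-elim (proj₁ (cfIntervals-apart pa pc a₀≡c₀ a₁<c₁) meets)
... | tri> _ _ c₁<a₁ = ⊥-elim (proj₂ (cfIntervals-apart pc pa (sym a₀≡c₀) c₁<a₁) meets)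

fromDigitsRev : ℕ → List ℕ → ℕ
fromDigitsRev b = foldr (λ d acc → acc * b + d) 0

fromDigits-reverse : ∀ b xs → fromDigits b (reverse xs) ≡ fromDigitsRev b xs
fromDigits-reverse b = reverse-foldl (λ acc d → acc * b + d) 0

digitsRev-zero : ∀ f b → digitsRev f (suc b) 0 ≡ []
digitsRev-zero zero b = refl
digitsRev-zero (suc f) b = refl

quotient-fuel : ∀ b f m → suc m ≤ suc f → suc m / suc (suc b) ≤ f
quotient-fuel b f m m<f = ≤-pred (<-≤-trans (m/n<m (suc m) (suc (suc b)) (s≤s (s≤s z≤n))) m<f)

fromDigitsRev-digitsRev : ∀ {b} → 2 ≤ b → ∀ f m → m ≤ f → fromDigitsRev b (digitsRev f b m) ≡ m
fromDigitsRev-digitsRev {b@(suc (suc _))} 2≤b@(s≤s (s≤s _)) f zero _ = cong (fromDigitsRev b) (digitsRev-zero f _)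
fromDigitsRev-digitsRev {b@(suc (suc _))} 2≤b@(s≤s (s≤s _)) (suc f) (suc m) m≤f = begin
  fromDigitsRev b (digitsRev f b (suc m / b)) * b + suc m % b
    ≡⟨ cong (λ v → v * b + suc m % b) (fromDigitsRev-digitsRev 2≤b f (suc m / b) (quotient-fuel _ f m m≤f)) ⟩
  suc m / b * b + suc m % b  ≡⟨ +-comm (suc m / b * b) (suc m % b) ⟩
  suc m % b + suc m / b * b  ≡⟨ m≡m%n+[m/n]*n (suc m) b ⟨
  suc m                      ∎
  where open ≡-Reasoning

digitsRev-length : ∀ {b} → 2 ≤ b → ∀ f m → m ≤ f → 0 < m →
                   Σ ℕ λ l → length (digitsRev f b m) ≡ suc l × b ^ l ≤ m
digitsRev-length {b@(suc (suc _))} 2≤b@(s≤s (s≤s _)) (suc f) (suc m) m≤f _ with suc m / b ≟ 0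
... | yes q≡0 = 0 , cong suc (trans (cong (λ q → length (digitsRev f b q)) q≡0)
                                     (cong length (digitsRev-zero f _))) , s≤s z≤n
... | no q≢0 with digitsRev-length 2≤b f (suc m / b) (quotient-fuel _ f m m≤f) (n≢0⇒n>0 q≢0)
...   | l , len≡ , bˡ≤q = suc l , cong suc len≡ , (begin
  b * b ^ l                 ≤⟨ *-monoʳ-≤ b bˡ≤q ⟩
  b * (suc m / b)           ≡⟨ *-comm b (suc m / b) ⟩
  suc m / b * b             ≤⟨ m≤n+m (suc m / b * b) (suc m % b) ⟩
  suc m % b + suc m / b * b ≡⟨ m≡m%n+[m/n]*n (suc m) b ⟨
  suc m                     ∎)
  where open ≤-Reasoning

fromDigits-digits : ∀ {b} → 2 ≤ b → ∀ m → fromDigits b (digits b m) ≡ m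
fromDigits-digits {b} 2≤b m =
  trans (fromDigits-reverse b (digitsRev m b m)) (fromDigitsRev-digitsRev 2≤b m m ≤-refl)

digits-length : ∀ {b} → 2 ≤ b → ∀ m → 0 < m → Σ ℕ λ l → length (digits b m) ≡ suc l × b ^ l ≤ m
digits-length {b} 2≤b m m>0 with digitsRev-length 2≤b m m ≤-refl m>0
... | l , len≡ , bˡ≤m = l , trans (length-reverse (digitsRev m b m)) len≡ , bˡ≤m

digits-single : ∀ {b} → 2 ≤ b → ∀ m → 0 < m → m < b → digits b m ≡ m ∷ []
digits-single {b@(suc (suc _))} (s≤s (s≤s _)) (suc m) _ m<b
  rewrite m<n⇒m%n≡m m<b | m<n⇒m/n≡0 m<b | digitsRev-zero m (pred b) = refl

fromDigits-∷ : ∀ b x xs → fromDigits b (x ∷ xs) ≡ x * b ^ length xs + fromDigits b xs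
fromDigits-∷ b = shift
  where
  step = λ acc d → acc * b + d
  shift : ∀ z ys → foldl step z ys ≡ z * b ^ length ys + foldl step 0 ys
  shift z [] = sym (trans (+-identityʳ (z * 1)) (*-identityʳ z))
  shift z (y ∷ ys) = begin
    foldl step (z * b + y) ys                          ≡⟨ shift (z * b + y) ys ⟩
    (z * b + y) * b ^ length ys + foldl step 0 ys      ≡⟨ regroup z b y (b ^ length ys) (foldl step 0 ys) ⟩
    z * (b * b ^ length ys) + (y * b ^ length ys + foldl step 0 ys)
      ≡⟨ cong (z * (b * b ^ length ys) +_) (shift y ys) ⟨
    z * (b * b ^ length ys) + foldl step y ys          ∎
    where
    open ≡-Reasoning
    regroup : ∀ z b y p r → (z * b + y) * p + r ≡ z * (b * p) + (y * p + r)
    regroup = solve-∀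

take-length-++ : ∀ {A : Set} (xs ys : List A) → take (length xs) (xs ++ ys) ≡ xs
take-length-++ [] ys = refl
take-length-++ (x ∷ xs) ys = cong (x ∷_) (take-length-++ xs ys)

digitInterval-first : ∀ {b} → 2 ≤ b → ∀ a l → length (digits b (a 0)) ≡ suc l →
                      digitInterval b a (suc l) ≡ ((a 0 , b ^ suc l) , (suc (a 0) , b ^ suc l))
digitInterval-first {b} 2≤b a l len≡ = cong (λ v → (v , b ^ suc l) , (suc v , b ^ suc l)) (begin
  fromDigits b (digitPrefix b a (suc l)) ≡⟨ cong (fromDigits b) prefix ⟩
  fromDigits b (digits b (a 0))          ≡⟨ fromDigits-digits 2≤b (a 0) ⟩
  a 0                                    ∎)
  where
  open ≡-Reasoning
  prefix : digitPrefix b a (suc l) ≡ digits b (a 0)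
  rest = concatMap (λ i → digits b (a i)) (applyUpTo suc l)
  prefix = subst (λ n → take n (digits b (a 0) ++ rest) ≡ digits b (a 0)) len≡
                 (take-length-++ (digits b (a 0)) rest)

digitInterval-second : ∀ {b} → 2 ≤ b → ∀ a l → 0 < a 0 → a 0 < b → length (digits b (a 1)) ≡ suc l →
  let v = a 0 * b ^ suc l + a 1 in
  digitInterval b a (2 + l) ≡ ((v , b * b ^ suc l) , (suc v , b * b ^ suc l))
digitInterval-second {b} 2≤b a l a₀>0 a₀<b len≡ =
  cong (λ v → (v , b * b ^ suc l) , (suc v , b * b ^ suc l)) (begin
  fromDigits b (digitPrefix b a (2 + l))                      ≡⟨ cong (fromDigits b) prefix ⟩
  fromDigits b (a 0 ∷ digits b (a 1))                         ≡⟨ fromDigits-∷ b (a 0) (digits b (a 1)) ⟩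
  a 0 * b ^ length (digits b (a 1)) + fromDigits b (digits b (a 1))
    ≡⟨ cong₂ (λ n v → a 0 * b ^ n + v) len≡ (fromDigits-digits 2≤b (a 1)) ⟩
  a 0 * b ^ suc l + a 1                                       ∎)
  where
  open ≡-Reasoning
  prefix : digitPrefix b a (2 + l) ≡ a 0 ∷ digits b (a 1)
  prefix rewrite digits-single 2≤b (a 0) a₀>0 a₀<b =
    cong (a 0 ∷_) (subst (λ n → take n (digits b (a 1) ++ rest) ≡ digits b (a 1)) len≡
                         (take-length-++ (digits b (a 1)) rest))
    where rest = concatMap (λ i → digits b (a i)) (applyUpTo (suc ∘ suc) l)

only-one-digit : ∀ {b m} l → 0 < b → b ^ l ≤ m → m * m < b ^ suc l → l ≡ 0
only-one-digit zero _ _ _ = refl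
only-one-digit {b} {m} (suc l) b>0 bˡ≤m m²<b^l = ⊥-elim (<⇒≱ m²<b^l (begin
  b * b ^ suc l        ≤⟨ *-monoˡ-≤ (b ^ suc l) b≤b^[1+l] ⟩
  b ^ suc l * b ^ suc l ≤⟨ *-mono-≤ bˡ≤m bˡ≤m ⟩
  m * m                ∎))
  where
  open ≤-Reasoning
  b≤b^[1+l] : b ≤ b ^ suc l
  b≤b^[1+l] = subst (_≤ b ^ suc l) (*-identityʳ b) (*-monoʳ-≤ b (m^n>0 b {{>-nonZero b>0}} l))

leading-quotient-squeeze : ∀ {b a} → 2 ≤ b → Trott b a → a 0 * a 0 < b × b < suc (a 0) * suc (a 0)
leading-quotient-squeeze {b} {a} 2≤b (pos , same) with digits-length 2≤b (a 0) (pos 0)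
... | l , len≡ , bˡ≤a₀ = subst (λ B → a 0 * a 0 < B × B < suc (a 0) * suc (a 0)) B≡b (a₀²<B , B<[a₀+1]²)
  where
  b>0 = ≤-trans (s≤s z≤n) 2≤b
  B = b ^ suc l
  B>0 = m^n>0 b {{>-nonZero b>0}} (suc l)
  bounds = meets-digitInterval (a 0) B B>0 (convergent-∈ pos 0) (convergent-∈ pos 1)
             (subst (Meets (cfInterval a 3)) (digitInterval-first 2≤b a l len≡) (same 3 (suc l)))
  a₀²<B : a 0 * a 0 < B
  a₀²<B = subst (a 0 * a 0 <_) (*-identityˡ B)
            (≤F-<F-trans {a 0 , B} {cf₂ (a 0) (suc (a 1))} {1 , a 0} B>0 (proj₂ bounds) (cf₂<1/q (a 0) (suc (a 1))))
  B<[a₀+1]² : B < suc (a 0) * suc (a 0)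
  B<[a₀+1]² = subst₂ _<_ (*-identityˡ B) (cong (suc (a 0) *_) (trans (+-comm (a 0 * 1) 1) (cong suc (*-identityʳ (a 0)))))
            (≤F-<F-trans {cf₂ (a 0) 1} {cf₂ (a 0) (a 1)} {suc (a 0) , B} (cf₂-den>0 (a 0) 1)
              (cf₂-monotone (a 0) (pos 1)) (proj₁ bounds))
  B≡b : B ≡ b
  B≡b = trans (cong (λ l → b ^ suc l) (only-one-digit l b>0 bˡ≤a₀ a₀²<B)) (*-identityʳ b)

leading-quotient : ∀ {b a} k → 2 ≤ k → k * k < b → b < suc k * suc k → Trott b a → a 0 ≡ k
leading-quotient k 2≤k k²<b b<[k+1]² trott =
  squeeze-unique (proj₁ squeeze) (proj₂ squeeze) k²<b b<[k+1]²
  where squeeze = leading-quotient-squeeze (proj₁ (between-squares⇒ 2≤k k²<b)) trott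

second-quotient-squeeze : ∀ {b a q t} → 2 ≤ b → Trott b a → a 0 ≡ q → a 1 ≡ t → q < b →
  Σ ℕ λ l → b ^ l ≤ t ×
    (let B = b ^ suc l in
     cf₂ q t <F (suc (q * B + t) , b * B) × (q * B + t , b * B) ≤F cf₂ q (suc t))
second-quotient-squeeze {b} {a} 2≤b (pos , same) refl refl a₀<b with digits-length 2≤b (a 1) (pos 1)
... | l , len≡ , bˡ≤a₁ = l , bˡ≤a₁ ,
  meets-digitInterval (a 0 * b ^ suc l + a 1) (b * b ^ suc l) (m^n>0 b {{>-nonZero b>0}} (2 + l))
    (convergent-∈ pos 0) (convergent-∈ pos 1)
    (subst (Meets (cfInterval a 3)) (digitInterval-second 2≤b a l (pos 0) a₀<b len≡) (same 3 (2 + l)))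
  where
  b>0 = ≤-trans (s≤s z≤n) 2≤b

-- With H = A (kA + k + 1), the second digit block pins the scale M of base k² + 1 between
-- H / (A + 1 − k) and H / (A − k), and the scale N of base k² + k between A + 2 and H / (k (A − 1)).

k²+1-block-inequalities : ∀ k A M →
  A * ((k * k + 1) * M) < suc (k * M + A) * (k * A + 1) →
  (k * M + A) * (k * suc A + 1) ≤ suc A * ((k * k + 1) * M) →
  k * M + A * (k * A + k + 1) ≤ M * suc A × M * A ≤ k * M + A * (k * A + k + 1)
k²+1-block-inequalities k A M lo hi =
  cancel-≤ (k * k * M * A + k * k * M) (hi-lhs k A M) (hi-rhs k A M) hi ,
  ≤-pred (cancel-< (k * k * M * A) (lo-lhs k A M) (lo-rhs k A M) lo)
  where
  lo-lhs : ∀ k A M → A * ((k * k + 1) * M) ≡ k * k * M * A + M * A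
  lo-lhs = solve-∀
  lo-rhs : ∀ k A M → suc (k * M + A) * (k * A + 1) ≡ k * k * M * A + suc (k * M + A * (k * A + k + 1))
  lo-rhs = solve-∀
  hi-lhs : ∀ k A M → (k * M + A) * (k * suc A + 1) ≡ (k * k * M * A + k * k * M) + (k * M + A * (k * A + k + 1))
  hi-lhs = solve-∀
  hi-rhs : ∀ k A M → suc A * ((k * k + 1) * M) ≡ (k * k * M * A + k * k * M) + M * suc A
  hi-rhs = solve-∀

k²+k-block-inequalities : ∀ k A N → 0 < A →
  A * ((k * k + k) * N) < suc (k * N + A) * (k * A + 1) →
  (k * N + A) * (k * suc A + 1) ≤ suc A * ((k * k + k) * N) →
  2 + A ≤ N × k * N * A ≤ k * N + A * (k * A + k + 1)
k²+k-block-inequalities k A N A>0 lo hi = 2+A≤N , ≤-pred (cancel-< (k * k * N * A) (lo-lhs k A N) (lo-rhs k A N) lo)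
  where
  lo-lhs : ∀ k A N → A * ((k * k + k) * N) ≡ k * k * N * A + k * N * A
  lo-lhs = solve-∀
  lo-rhs : ∀ k A N → suc (k * N + A) * (k * A + 1) ≡ k * k * N * A + suc (k * N + A * (k * A + k + 1))
  lo-rhs = solve-∀
  hi-lhs : ∀ k A N → (k * N + A) * (k * suc A + 1) ≡ (k * k * N * A + k * k * N + k * N) + A * (k * A + k + 1)
  hi-lhs = solve-∀
  hi-rhs : ∀ k A N → suc A * ((k * k + k) * N) ≡ (k * k * N * A + k * k * N + k * N) + A * (k * N)
  hi-rhs = solve-∀
  succ-form : ∀ k A → k * A + k + 1 ≡ suc (k * suc A)
  succ-form = solve-∀
  k[A+1]<kN : k * suc A < k * N
  k[A+1]<kN = subst (_≤ k * N) (succ-form k A)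
    (*-cancelˡ-≤ A {{>-nonZero A>0}} (cancel-≤ _ (hi-lhs k A N) (hi-rhs k A N) hi))
  2+A≤N : 2 + A ≤ N
  2+A≤N = *-cancelˡ-< k (suc A) N k[A+1]<kN

M-lower⇒k≤A : ∀ k A M → 0 < A → k * M + A * (k * A + k + 1) ≤ M * suc A → k ≤ A
M-lower⇒k≤A k A M A>0 M-lower = ≤-pred (*-cancelˡ-< M k (suc A) (begin-strict
  M * k                         ≡⟨ *-comm M k ⟩
  k * M                         <⟨ m<m+n (k * M) (*-mono-≤ A>0 (m≤n+m 1 (k * A + k))) ⟩
  k * M + A * (k * A + k + 1)   ≤⟨ M-lower ⟩
  M * suc A                     ∎))
  where open ≤-Reasoning

-- `identity` is A (kA + k + 1) − L (u + 1) = (k − 1)(k² + 1), rearranged to avoid subtraction.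
M-lower⇒kA+k²+1<M : ∀ k A M → 2 ≤ k → 0 < A →
                     k * M + A * (k * A + k + 1) ≤ M * suc A → k * A + k * k + 1 < M
M-lower⇒kA+k²+1<M k A M 2≤k A>0 M-lower with m≤n⇒∃[o]m+o≡n (M-lower⇒k≤A k A M A>0 M-lower)
... | u , refl with k * A + k * k + 1 <? M
...   | yes L<M = L<M
...   | no L≮M = ⊥-elim (<⇒≱ k²+1<k[k²+1] (cancel-≤ (L * suc u) (identity k u) refl (begin
    A * (k * A + k + 1) + (k * k + 1) ≤⟨ +-monoˡ-≤ (k * k + 1) H≤M[1+u] ⟩
    M * suc u + (k * k + 1)           ≤⟨ +-monoˡ-≤ (k * k + 1) (*-monoˡ-≤ (suc u) (≮⇒≥ L≮M)) ⟩
    L * suc u + (k * k + 1)           ∎)))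
  where
  open ≤-Reasoning
  L = k * A + k * k + 1
  H≤M[1+u] : A * (k * A + k + 1) ≤ M * suc u
  H≤M[1+u] = cancel-≤ (k * M) refl (split k u M) M-lower
    where
    split : ∀ k u M → M * suc (k + u) ≡ k * M + M * suc u
    split = solve-∀
  identity : ∀ k u → (k + u) * (k * (k + u) + k + 1) + (k * k + 1)
                     ≡ (k * (k + u) + k * k + 1) * suc u + k * (k * k + 1)
  identity = solve-∀
  k²+1<k[k²+1] : k * k + 1 < k * (k * k + 1)
  k²+1<k[k²+1] = subst (k * k + 1 <_) (*-comm (k * k + 1) k)
                   (m<m*n (k * k + 1) k {{>-nonZero (m≤n+m 1 (k * k))}} 2≤k)

kA≤3k+A⇒A≤k²+k : ∀ k A → 2 ≤ k → k * A ≤ 3 * k + A → A ≤ k * k + k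
kA≤3k+A⇒A≤k²+k k@(suc (suc j)) A (s≤s (s≤s z≤n)) kA≤3k+A with A ≤? k * k + k
... | yes A≤ = A≤
... | no A≰ with m≤n⇒∃[o]m+o≡n (≰⇒> A≰)
...   | t , refl = ⊥-elim (<⇒≱ (subst (3 * k + A <_) (sym (excess j t)) (m<m+n _ (s≤s z≤n))) kA≤3k+A)
  where
  excess : ∀ j t → (2 + j) * (suc ((2 + j) * (2 + j) + (2 + j)) + t)
                   ≡ 3 * (2 + j) + (suc ((2 + j) * (2 + j) + (2 + j)) + t)
                     + suc (9 * j + t + j * t + 6 * j * j + j * j * j)
  excess = solve-∀

N>A+2⇒A≤k²+k : ∀ k A N s → 2 ≤ k → 0 < A → 2 + A + suc s ≡ N →
               k * N * A ≤ k * N + A * (k * A + k + 1) → A ≤ k * k + k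
N>A+2⇒A≤k²+k k A _ s 2≤k A>0 refl N-upper =
  kA≤3k+A⇒A≤k²+k k A 2≤k (+-cancelʳ-≤ (k * s) (k * A) (3 * k + A) (begin
    k * A + k * s      ≤⟨ +-monoʳ-≤ (k * A) (m≤m*n (k * s) A {{>-nonZero A>0}}) ⟩
    k * A + k * s * A  ≤⟨ cancel-≤ (k * A * A + 2 * k * A) (lhs k A s) (rhs k A s) N-upper ⟩
    3 * k + A + k * s  ∎))
  where
  open ≤-Reasoning
  lhs : ∀ k A s → k * (2 + A + suc s) * A ≡ (k * A * A + 2 * k * A) + (k * A + k * s * A)
  lhs = solve-∀
  rhs : ∀ k A s → k * (2 + A + suc s) + A * (k * A + k + 1) ≡ (k * A * A + 2 * k * A) + (3 * k + A + k * s)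
  rhs = solve-∀

[k+1]²+2<[k²+k]² : ∀ k → 2 ≤ k → 2 + (k * k + 2 * k + 1) < (k * k + k) * (k * k + k)
[k+1]²+2<[k²+k]² (suc (suc j)) (s≤s (s≤s z≤n)) = subst (2 + (k * k + 2 * k + 1) <_) (sym (identity j)) (m<m+n _ (s≤s z≤n))
  where
  k = 2 + j
  identity : ∀ j → ((2 + j) * (2 + j) + (2 + j)) * ((2 + j) * (2 + j) + (2 + j))
                   ≡ 2 + ((2 + j) * (2 + j) + 2 * (2 + j) + 1)
                     + suc (24 + 54 * j + 36 * j * j + 10 * j * j * j + j * j * j * j)
  identity = solve-∀

M-upper⇒A≤[k+1]² : ∀ k A M → 0 < k → M * A ≤ k * M + A * (k * A + k + 1) →
           k * A + 2 * k + k * k + 1 ≤ M → A ≤ k * k + 2 * k + 1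
M-upper⇒A≤[k+1]² k A M k>0 M-upper L≤M with A ≤? k * k + 2 * k + 1
... | yes A≤ = A≤
... | no A≰ with m≤n⇒∃[o]m+o≡n (≰⇒> A≰)
...   | t , refl = ⊥-elim (<-irrefl refl (begin-strict
  H                                   <⟨ m<m+n H (*-mono-≤ k>0 (s≤s z≤n)) ⟩
  H + k * suc t                       ≡⟨ identity k t ⟨
  (k * A + 2 * k + k * k + 1) * u     ≤⟨ *-monoˡ-≤ u L≤M ⟩
  M * u                               ≤⟨ cancel-≤ (k * M) (split k t M) refl M-upper ⟩
  H                                   ∎))
  where
  open ≤-Reasoning
  u = k * k + k + 2 + t
  H = A * (k * A + k + 1)
  split : ∀ k t M → M * (suc (k * k + 2 * k + 1) + t) ≡ k * M + M * (k * k + k + 2 + t)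
  split = solve-∀
  identity : ∀ k t → let A = suc (k * k + 2 * k + 1) + t in
             (k * A + 2 * k + k * k + 1) * (k * k + k + 2 + t) ≡ A * (k * A + k + 1) + k * suc t
  identity = solve-∀

-- Since k (A + 2) = k (k² + k) X ≡ 0 and M ≡ 1 (mod k²), the bound kA + k² + 1 < M rounds up
-- to kA + 2k + k² + 1 ≤ M; the upper bound on M then gives A ≤ (k + 1)², which forces X = 1.
N≡A+2⇒A≤k²+k : ∀ k A X R M → 2 ≤ k → (X ≡ 1 ⊎ k * k + k ≤ X) → (k * k + k) * X ≡ 2 + A →
              M ≡ 1 + k * k * R → k * A + k * k + 1 < M →
              M * A ≤ k * M + A * (k * A + k + 1) → A ≤ k * k + k
N≡A+2⇒A≤k²+k k A X R M 2≤k X-shape N≡ M≡ large-M M-upper with X-shape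
... | inj₁ refl = subst (A ≤_) (trans (sym N≡) (*-identityʳ (k * k + k))) (m≤n+m A 2)
... | inj₂ X≥ = ⊥-elim (<⇒≱ ([k+1]²+2<[k²+k]² k 2≤k) (begin
  (k * k + k) * (k * k + k)   ≤⟨ *-monoʳ-≤ (k * k + k) X≥ ⟩
  (k * k + k) * X             ≡⟨ N≡ ⟩
  2 + A                       ≤⟨ +-monoʳ-≤ 2 (M-upper⇒A≤[k+1]² k A M (≤-trans (s≤s z≤n) 2≤k) M-upper rounded) ⟩
  2 + (k * k + 2 * k + 1)     ∎))
  where
  open ≤-Reasoning
  Q = (k + 1) * X
  kA+2k≡k²Q : k * A + 2 * k ≡ k * k * Q
  kA+2k≡k²Q = trans (expand k A) (trans (cong (k *_) (sym N≡)) (regroup k X))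
    where
    expand : ∀ k A → k * A + 2 * k ≡ k * (2 + A)
    expand = solve-∀
    regroup : ∀ k X → k * ((k * k + k) * X) ≡ k * k * ((k + 1) * X)
    regroup = solve-∀
  Q<R : Q < R
  Q<R = *-cancelˡ-< (k * k) Q R (begin-strict
    k * k * Q      ≡⟨ kA+2k≡k²Q ⟨
    k * A + 2 * k  ≤⟨ +-monoʳ-≤ (k * A) (*-monoˡ-≤ k 2≤k) ⟩
    k * A + k * k  <⟨ cancel-< 1 (+-comm (k * A + k * k) 1) M≡ large-M ⟩
    k * k * R      ∎)
  rounded : k * A + 2 * k + k * k + 1 ≤ M
  rounded = begin
    k * A + 2 * k + k * k + 1  ≡⟨ cong (λ z → z + k * k + 1) kA+2k≡k²Q ⟩
    k * k * Q + k * k + 1      ≡⟨ next-multiple k Q ⟩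
    1 + k * k * suc Q          ≤⟨ +-monoʳ-≤ 1 (*-monoʳ-≤ (k * k) Q<R) ⟩
    1 + k * k * R              ≡⟨ M≡ ⟨
    M                          ∎
    where
    next-multiple : ∀ k Q → k * k * Q + k * k + 1 ≡ 1 + k * k * suc Q
    next-multiple = solve-∀

A∉[k²+1,k²+k] : ∀ k A M → 2 ≤ k → M * A ≤ k * M + A * (k * A + k + 1) →
               (k * k + 1) * (k * k + 1) ≤ M → k * k + 1 ≤ A → A ≤ k * k + k → ⊥
A∉[k²+1,k²+k] k@(suc (suc j)) A M (s≤s (s≤s z≤n)) M-upper M≥ A≥ A≤ with m≤n⇒∃[o]m+o≡n A≥
... | t , refl = <⇒≱ (subst (rest + k * (k * k) * u <_) (sym (bound j t)) (m<m+n _ (s≤s z≤n)))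
  (begin
    (k * k + 1) * (k * k + 1) * u   ≤⟨ *-monoˡ-≤ u M≥ ⟩
    M * u                           ≤⟨ cancel-≤ (k * M) (split j t M) refl M-upper ⟩
    A * (k * A + k + 1)             ≡⟨ expand j t ⟩
    rest + k * u * u                ≤⟨ +-monoʳ-≤ rest (*-monoˡ-≤ u (*-monoʳ-≤ k u≤k²)) ⟩
    rest + k * (k * k) * u          ∎)
  where
  open ≤-Reasoning
  u = 3 + 3 * j + j * j + t
  rest = k * k * k + 2 * k * k * u + k * k + k + k * u + u
  u≤k² : u ≤ k * k
  u≤k² = +-cancelˡ-≤ k u (k * k) (subst₂ _≤_ (A≡k+u j t) (+-comm (k * k) k) A≤)
    where
    A≡k+u : ∀ j t → (2 + j) * (2 + j) + 1 + t ≡ (2 + j) + (3 + 3 * j + j * j + t)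
    A≡k+u = solve-∀
  split : ∀ j t M → M * ((2 + j) * (2 + j) + 1 + t) ≡ (2 + j) * M + M * (3 + 3 * j + j * j + t)
  split = solve-∀
  expand : ∀ j t → let k = 2 + j; u = 3 + 3 * j + j * j + t; A = k * k + 1 + t in
           A * (k * A + k + 1) ≡ (k * k * k + 2 * k * k * u + k * k + k + k * u + u) + k * u * u
  expand = solve-∀
  bound : ∀ j t → let k = 2 + j; u = 3 + 3 * j + j * j + t in
          (k * k + 1) * (k * k + 1) * u
          ≡ (k * k * k + 2 * k * k * u + k * k + k + k * u + u) + k * (k * k) * u
            + suc (3 + 58 * j + 6 * t + 19 * j * t + 110 * j * j + 18 * j * j * t + 93 * j * j * j
                   + 7 * j * j * j * t + 42 * j * j * j * j + j * j * j * j * t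
                   + 10 * j * j * j * j * j + j * j * j * j * j * j)
  bound = solve-∀

trott-inequalities-incompatible : ∀ k A d e → 2 ≤ k → 0 < A → (k * k + 1) ^ d ≤ A →
  let M = (k * k + 1) ^ suc d
      N = (k * k + k) ^ suc e
  in 2 + A ≤ N → k * N * A ≤ k * N + A * (k * A + k + 1) →
     k * M + A * (k * A + k + 1) ≤ M * suc A → M * A ≤ k * M + A * (k * A + k + 1) → ⊥
trott-inequalities-incompatible k A d e 2≤k A>0 Y≤A N≥A+2 N-upper M-lower M-upper
  with pow-one-or-large (k * k + 1) d (m≤n+m 1 (k * k))
... | inj₁ Y≡1 = <⇒≱ large-M (begin
  (k * k + 1) * (k * k + 1) ^ d ≡⟨ cong ((k * k + 1) *_) Y≡1 ⟩
  (k * k + 1) * 1               ≡⟨ *-identityʳ (k * k + 1) ⟩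
  k * k + 1                     ≤⟨ +-monoˡ-≤ 1 (m≤n+m (k * k) (k * A)) ⟩
  k * A + k * k + 1             ∎)
  where
  open ≤-Reasoning
  large-M = M-lower⇒kA+k²+1<M k A _ 2≤k A>0 M-lower
... | inj₂ Y≥k²+1 =
  A∉[k²+1,k²+k] k A M 2≤k M-upper (*-monoʳ-≤ (k * k + 1) Y≥k²+1) (≤-trans Y≥k²+1 Y≤A) A≤k²+k
  where
  M = (k * k + 1) ^ suc d
  N = (k * k + k) ^ suc e
  A≤k²+k : A ≤ k * k + k
  A≤k²+k with m≤n⇒∃[o]m+o≡n N≥A+2 | pow-≡1-mod (k * k) (suc d)
  ... | zero , N≡ | R , M≡ =
    N≡A+2⇒A≤k²+k k A ((k * k + k) ^ e) R M 2≤k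
      (pow-one-or-large (k * k + k) e (≤-trans (≤-trans (s≤s z≤n) 2≤k) (m≤n+m k (k * k))))
      (trans (sym N≡) (+-identityʳ (2 + A))) M≡ (M-lower⇒kA+k²+1<M k A M 2≤k A>0 M-lower) M-upper
  ... | suc s , N≡ | _ = N>A+2⇒A≤k²+k k A N s 2≤k A>0 N≡ N-upper

proposition6p6 : (k : ℕ) → 2 ≤ k → (a c : ℕ → ℕ) →
    Trott (k * k + 1) a → Trott (k * k + k) c →
    SameReal (cfInterval a) (cfInterval c) → ⊥
proposition6p6 k 2≤k a c ta@(pa , _) tc@(pc , _) same =
  let k>0 = ≤-trans (s≤s z≤n) 2≤k
      (k²<b₁ , b₁<[k+1]²) = k²<k²+1<[k+1]² k k>0
      (k²<b₂ , b₂<[k+1]²) = k²<k²+k<[k+1]² k k>0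
      a₀≡k = leading-quotient k 2≤k k²<b₁ b₁<[k+1]² ta
      c₀≡k = leading-quotient k 2≤k k²<b₂ b₂<[k+1]² tc
      a₁≡c₁ = second-quotients-agree pa pc (trans a₀≡k (sym c₀≡k)) (same 3 3)
      (2≤b₁ , k<b₁) = between-squares⇒ 2≤k k²<b₁
      (2≤b₂ , k<b₂) = between-squares⇒ 2≤k k²<b₂
      (d , [k²+1]ᵈ≤a₁ , lo-a , hi-a) = second-quotient-squeeze 2≤b₁ ta a₀≡k refl k<b₁
      (e , _ , lo-c , hi-c) = second-quotient-squeeze 2≤b₂ tc c₀≡k (sym a₁≡c₁) k<b₂
      (M-lower , M-upper) = k²+1-block-inequalities k (a 1) _ lo-a hi-a
      (N≥A+2 , N-upper) = k²+k-block-inequalities k (a 1) _ (pa 1) lo-c hi-c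
  in trott-inequalities-incompatible k (a 1) d e 2≤k (pa 1) [k²+1]ᵈ≤a₁ N≥A+2 N-upper M-lower M-upper
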